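{- Let $1\to A\to G\xrightarrow{\kappa}H\to1$ be an exact sequence of finite groups with $A$ abelian (identified with a normal subgroup of $G$). Define $\Psi:H\to\mathrm{Aut}(A)$ by $\Psi(h)(a)=gag^{ -1}$ for any $g\in G$ with $\kappa(g)=h$ (well defined since $A$ is abelian), and let $A\rtimes H$ be the corresponding semidirect product (multiplication $(a_1,h_1)(a_2,h_2)=(a_1\Psi(h_1)(a_2),h_1h_2)$), with projection $\pi:A\rtimes H\to H$, $(a,h)\mapsto h$. Then $$G\times_H G\cong G\times_H(A\rtimes H),$$ where the right side is the fiber product with respect to $\kappa$ and $\pi$. Furthermore, $\{(a,a):a\in A\}$ is a normal subgroup of $G\times_H G$ and $$A\rtimes H\cong (G\times_H G)/\{(a,a)\mid a\in A\}.$$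
   Context: For finite groups $G_1,G_2,H$ and epimorphisms $\kappa_i:G_i\to H$, the subdirect (fiber) product is $G_1\times_H G_2:=\{(g_1,g_2): g_i\in G_i,\ \kappa_1(g_1)=\kappa_2(g_2)\}$ with componentwise multiplication. $G\times_H G$ is formed with $\kappa_1=\kappa_2=\kappa$. -}

module Defs where

open import Level using (Level; _⊔_)
open import Data.Nat using (ℕ)
open import Data.Fin using (Fin)
open import Data.Product using (Σ; _×_; _,_; proj₁; proj₂)
open import Relation.Unary using (Pred)
open import Function.Definitions using (Injective; Surjective)
open import Algebra.Bundles using (Group; AbelianGroup)
open import Algebra.Morphism.Structures using (IsGroupHomomorphism; IsGroupIsomorphism)
import Algebra.Properties.Group as GP
import Relation.Binary.Reasoning.Setoid as SR

IsFiniteGroup : ∀ {c ℓ} → Group c ℓ → Set (c ⊔ ℓ)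
IsFiniteGroup G =
  Σ ℕ λ n → Σ (Fin n → Carrier) λ f → ∀ x → Σ (Fin n) λ i → f i ≈ x
  where open Group G

_≅_ : ∀ {a ℓ₁ b ℓ₂} → Group a ℓ₁ → Group b ℓ₂ → Set (a ⊔ b ⊔ ℓ₁ ⊔ ℓ₂)
G₁ ≅ G₂ = Σ (Group.Carrier G₁ → Group.Carrier G₂) λ f →
  IsGroupIsomorphism (Group.rawGroup G₁) (Group.rawGroup G₂) f

module _ {a ℓ} (G : Group a ℓ) where
  private module G = Group G
  record IsNormalSubgroup {p} (N : Pred G.Carrier p) : Set (a ⊔ ℓ ⊔ p) where
    field
      resp        : ∀ {x y} → x G.≈ y → N x → N y
      has-ε       : N G.ε
      ∙-closed    : ∀ {x y} → N x → N y → N (x G.∙ y)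
      ⁻¹-closed   : ∀ {x} → N x → N (x G.⁻¹)
      conj-closed : ∀ g {x} → N x → N (g G.∙ x G.∙ g G.⁻¹)

module Conj {a ℓ} (G : Group a ℓ) where
  open Group G
  open GP G
  open SR setoid

  conj : Carrier → Carrier → Carrier
  conj g x = g ∙ x ∙ g ⁻¹

  conj-cong : ∀ {g g' x x'} → g ≈ g' → x ≈ x' → conj g x ≈ conj g' x'
  conj-cong p q = ∙-cong (∙-cong p q) (⁻¹-cong p)

  cancel-mid : ∀ u g v → u ∙ g ⁻¹ ∙ (g ∙ v) ≈ u ∙ v
  cancel-mid u g v = begin
    u ∙ g ⁻¹ ∙ (g ∙ v)   ≈⟨ assoc u (g ⁻¹) (g ∙ v) ⟩
    u ∙ (g ⁻¹ ∙ (g ∙ v)) ≈⟨ ∙-congˡ (assoc (g ⁻¹) g v) ⟨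
    u ∙ (g ⁻¹ ∙ g ∙ v)   ≈⟨ ∙-congˡ (∙-congʳ (inverseˡ g)) ⟩
    u ∙ (ε ∙ v)          ≈⟨ ∙-congˡ (identityˡ v) ⟩
    u ∙ v                ∎

  conj-∙ : ∀ g x y → conj g (x ∙ y) ≈ conj g x ∙ conj g y
  conj-∙ g x y = begin
    g ∙ (x ∙ y) ∙ g ⁻¹               ≈⟨ ∙-congʳ (assoc g x y) ⟨
    g ∙ x ∙ y ∙ g ⁻¹                 ≈⟨ ∙-congʳ (cancel-mid (g ∙ x) g y) ⟨
    g ∙ x ∙ g ⁻¹ ∙ (g ∙ y) ∙ g ⁻¹    ≈⟨ assoc (g ∙ x ∙ g ⁻¹) (g ∙ y) (g ⁻¹) ⟩
    conj g x ∙ conj g y              ∎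

  conj-conj : ∀ g g' x → conj g (conj g' x) ≈ conj (g ∙ g') x
  conj-conj g g' x = sym (begin
    g ∙ g' ∙ x ∙ (g ∙ g') ⁻¹           ≈⟨ ∙-congˡ (⁻¹-anti-homo-∙ g g') ⟩
    g ∙ g' ∙ x ∙ (g' ⁻¹ ∙ g ⁻¹)        ≈⟨ assoc (g ∙ g' ∙ x) (g' ⁻¹) (g ⁻¹) ⟨
    g ∙ g' ∙ x ∙ g' ⁻¹ ∙ g ⁻¹          ≈⟨ ∙-congʳ (∙-congʳ (assoc g g' x)) ⟩
    g ∙ (g' ∙ x) ∙ g' ⁻¹ ∙ g ⁻¹        ≈⟨ ∙-congʳ (assoc g (g' ∙ x) (g' ⁻¹)) ⟩
    g ∙ (g' ∙ x ∙ g' ⁻¹) ∙ g ⁻¹        ∎)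

  conj-ε : ∀ x → conj ε x ≈ x
  conj-ε x = begin
    ε ∙ x ∙ ε ⁻¹ ≈⟨ ∙-cong (identityˡ x) ε⁻¹≈ε ⟩
    x ∙ ε        ≈⟨ identityʳ x ⟩
    x            ∎

  conj-of-ε : ∀ g → conj g ε ≈ ε
  conj-of-ε g = begin
    g ∙ ε ∙ g ⁻¹ ≈⟨ ∙-congʳ (identityʳ g) ⟩
    g ∙ g ⁻¹     ≈⟨ inverseʳ g ⟩
    ε            ∎

  inv-div : ∀ x y → (x ∙ y ⁻¹) ⁻¹ ≈ y ∙ x ⁻¹
  inv-div x y = trans (⁻¹-anti-homo-∙ x (y ⁻¹)) (∙-congʳ (⁻¹-involutive y))

module _ {c₁ ℓ₁ c₂ ℓ₂ c₃ ℓ₃}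
         (G₁ : Group c₁ ℓ₁) (G₂ : Group c₂ ℓ₂) (H : Group c₃ ℓ₃)
         (κ₁ : Group.Carrier G₁ → Group.Carrier H)
         (κ₁-hom : IsGroupHomomorphism (Group.rawGroup G₁) (Group.rawGroup H) κ₁)
         (κ₂ : Group.Carrier G₂ → Group.Carrier H)
         (κ₂-hom : IsGroupHomomorphism (Group.rawGroup G₂) (Group.rawGroup H) κ₂)
         where
  private
    module G₁ = Group G₁
    module G₂ = Group G₂
    module H = Group H
    module h₁ = IsGroupHomomorphism κ₁-hom
    module h₂ = IsGroupHomomorphism κ₂-hom

    C : Set (c₁ ⊔ c₂ ⊔ ℓ₃)
    C = Σ (G₁.Carrier × G₂.Carrier) λ p → κ₁ (proj₁ p) H.≈ κ₂ (proj₂ p)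

    fst : C → G₁.Carrier
    fst x = proj₁ (proj₁ x)
    snd : C → G₂.Carrier
    snd x = proj₂ (proj₁ x)

    infix 4 _≈_
    infixl 7 _∙_
    infix 8 _⁻¹
    _≈_ : C → C → Set (ℓ₁ ⊔ ℓ₂)
    x ≈ y = (fst x G₁.≈ fst y) × (snd x G₂.≈ snd y)

    _∙_ : C → C → C
    x ∙ y = (fst x G₁.∙ fst y , snd x G₂.∙ snd y) , e
      where
      open SR H.setoid
      e = begin
        κ₁ (fst x G₁.∙ fst y)     ≈⟨ h₁.homo (fst x) (fst y) ⟩
        κ₁ (fst x) H.∙ κ₁ (fst y) ≈⟨ H.∙-cong (proj₂ x) (proj₂ y) ⟩
        κ₂ (snd x) H.∙ κ₂ (snd y) ≈⟨ h₂.homo (snd x) (snd y) ⟨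
        κ₂ (snd x G₂.∙ snd y)     ∎

    ε : C
    ε = (G₁.ε , G₂.ε) , H.trans h₁.ε-homo (H.sym h₂.ε-homo)

    _⁻¹ : C → C
    x ⁻¹ = (fst x G₁.⁻¹ , snd x G₂.⁻¹) ,
      H.trans (h₁.⁻¹-homo (fst x))
        (H.trans (H.⁻¹-cong (proj₂ x)) (H.sym (h₂.⁻¹-homo (snd x))))

  FibreProduct : Group (c₁ ⊔ c₂ ⊔ ℓ₃) (ℓ₁ ⊔ ℓ₂)
  FibreProduct = record
    { Carrier = C
    ; _≈_ = _≈_
    ; _∙_ = _∙_
    ; ε = ε
    ; _⁻¹ = _⁻¹
    ; isGroup = record
      { isMonoid = record
        { isSemigroup = record
          { isMagma = record
            { isEquivalence = record
              { refl = G₁.refl , G₂.refl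
              ; sym = λ p → G₁.sym (proj₁ p) , G₂.sym (proj₂ p)
              ; trans = λ p q → G₁.trans (proj₁ p) (proj₁ q) , G₂.trans (proj₂ p) (proj₂ q)
              }
            ; ∙-cong = λ p q → G₁.∙-cong (proj₁ p) (proj₁ q) , G₂.∙-cong (proj₂ p) (proj₂ q)
            }
          ; assoc = λ x y z → G₁.assoc (fst x) (fst y) (fst z) , G₂.assoc (snd x) (snd y) (snd z)
          }
        ; identity = (λ x → G₁.identityˡ (fst x) , G₂.identityˡ (snd x))
                   , (λ x → G₁.identityʳ (fst x) , G₂.identityʳ (snd x))
        }
      ; inverse = (λ x → G₁.inverseˡ (fst x) , G₂.inverseˡ (snd x))
                , (λ x → G₁.inverseʳ (fst x) , G₂.inverseʳ (snd x))
      ; ⁻¹-cong = λ p → G₁.⁻¹-cong (proj₁ p) , G₂.⁻¹-cong (proj₂ p)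
      }
    }

-- Quotient of a group by a normal subgroup (as a setoid quotient:
-- same carrier, x ~ y iff x ∙ y⁻¹ ∈ N)

module _ {a ℓ p} (G : Group a ℓ) (N : Pred (Group.Carrier G) p)
         (nor : IsNormalSubgroup G N) where
  private
    open Group G
    open GP G
    open Conj G
    module N = IsNormalSubgroup nor

    infix 4 _~_
    _~_ : Carrier → Carrier → Set p
    x ~ y = N (x ∙ y ⁻¹)

    ≈⇒~ : ∀ {x y} → x ≈ y → x ~ y
    ≈⇒~ q = N.resp (sym (x≈y⇒x∙y⁻¹≈ε q)) N.has-ε

    ~-sym : ∀ {x y} → x ~ y → y ~ x
    ~-sym {x} {y} q = N.resp (inv-div x y) (N.⁻¹-closed q)

    ~-trans : ∀ {x y z} → x ~ y → y ~ z → x ~ z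
    ~-trans {x} {y} {z} q r = N.resp (cancel-mid x y (z ⁻¹)) (N.∙-closed q r)

    ~-∙ : ∀ {x x' y y'} → x ~ x' → y ~ y' → (x ∙ y) ~ (x' ∙ y')
    ~-∙ {x} {x'} {y} {y'} q r =
      N.resp eq (N.∙-closed (N.conj-closed x r) q)
      where
      open SR setoid
      eq = begin
        x ∙ (y ∙ y' ⁻¹) ∙ x ⁻¹ ∙ (x ∙ x' ⁻¹) ≈⟨ cancel-mid (x ∙ (y ∙ y' ⁻¹)) x (x' ⁻¹) ⟩
        x ∙ (y ∙ y' ⁻¹) ∙ x' ⁻¹              ≈⟨ ∙-congʳ (assoc x y (y' ⁻¹)) ⟨
        x ∙ y ∙ y' ⁻¹ ∙ x' ⁻¹                ≈⟨ assoc (x ∙ y) (y' ⁻¹) (x' ⁻¹) ⟩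
        x ∙ y ∙ (y' ⁻¹ ∙ x' ⁻¹)              ≈⟨ ∙-congˡ (⁻¹-anti-homo-∙ x' y') ⟨
        x ∙ y ∙ (x' ∙ y') ⁻¹                 ∎

    ~-⁻¹ : ∀ {x y} → x ~ y → (x ⁻¹) ~ (y ⁻¹)
    ~-⁻¹ {x} {y} q = N.resp eq (N.conj-closed (x ⁻¹) (N.⁻¹-closed q))
      where
      open SR setoid
      eq = begin
        x ⁻¹ ∙ (x ∙ y ⁻¹) ⁻¹ ∙ x ⁻¹ ⁻¹   ≈⟨ ∙-congʳ (∙-congˡ (inv-div x y)) ⟩
        x ⁻¹ ∙ (y ∙ x ⁻¹) ∙ x ⁻¹ ⁻¹      ≈⟨ ∙-congʳ (assoc (x ⁻¹) y (x ⁻¹)) ⟨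
        x ⁻¹ ∙ y ∙ x ⁻¹ ∙ x ⁻¹ ⁻¹        ≈⟨ assoc (x ⁻¹ ∙ y) (x ⁻¹) (x ⁻¹ ⁻¹) ⟩
        x ⁻¹ ∙ y ∙ (x ⁻¹ ∙ x ⁻¹ ⁻¹)      ≈⟨ ∙-congˡ (inverseʳ (x ⁻¹)) ⟩
        x ⁻¹ ∙ y ∙ ε                     ≈⟨ identityʳ (x ⁻¹ ∙ y) ⟩
        x ⁻¹ ∙ y                         ≈⟨ ∙-congˡ (⁻¹-involutive y) ⟨
        x ⁻¹ ∙ y ⁻¹ ⁻¹                   ∎

  Quotient : Group a p
  Quotient = record
    { Carrier = Carrier
    ; _≈_ = _~_
    ; _∙_ = _∙_
    ; ε = ε
    ; _⁻¹ = _⁻¹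
    ; isGroup = record
      { isMonoid = record
        { isSemigroup = record
          { isMagma = record
            { isEquivalence = record
              { refl = ≈⇒~ refl ; sym = ~-sym ; trans = ~-trans }
            ; ∙-cong = ~-∙
            }
          ; assoc = λ x y z → ≈⇒~ (assoc x y z)
          }
        ; identity = (λ x → ≈⇒~ (identityˡ x)) , (λ x → ≈⇒~ (identityʳ x))
        }
      ; inverse = (λ x → ≈⇒~ (inverseˡ x)) , (λ x → ≈⇒~ (inverseʳ x))
      ; ⁻¹-cong = ~-⁻¹
      }
    }

module _ {c ℓ} (A : AbelianGroup c ℓ) (G H : Group c ℓ) where
  private
    module A = AbelianGroup A
    module G = Group G
    module H = Group H
  record ShortExact : Set (c ⊔ ℓ) where
    field
      ι      : A.Carrier → G.Carrier
      ι-hom  : IsGroupHomomorphism A.rawGroup G.rawGroup ι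
      ι-inj  : Injective A._≈_ G._≈_ ι
      κ      : G.Carrier → H.Carrier
      κ-hom  : IsGroupHomomorphism G.rawGroup H.rawGroup κ
      κ-surj : Surjective G._≈_ H._≈_ κ
      im⊆ker : ∀ a → κ (ι a) H.≈ H.ε
      ker⊆im : ∀ g → κ g H.≈ H.ε → Σ A.Carrier λ a → ι a G.≈ g

module SES {c ℓ} {A : AbelianGroup c ℓ} {G H : Group c ℓ}
           (E : ShortExact A G H) where
  open ShortExact E
  private
    module A = AbelianGroup A
    module G = Group G
    module H = Group H
    module GPG = GP G
    module ιh = IsGroupHomomorphism ι-hom
    module κh = IsGroupHomomorphism κ-hom
    open Conj G

  s : H.Carrier → G.Carrier
  s h = proj₁ (κ-surj h)

  κs : ∀ h → κ (s h) H.≈ h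
  κs h = proj₂ (κ-surj h) G.refl

  private
    conj-inker : ∀ g a → κ (conj g (ι a)) H.≈ H.ε
    conj-inker g a = begin
      κ (g G.∙ ι a G.∙ g G.⁻¹)             ≈⟨ κh.homo (g G.∙ ι a) (g G.⁻¹) ⟩
      κ (g G.∙ ι a) H.∙ κ (g G.⁻¹)         ≈⟨ H.∙-cong (κh.homo g (ι a)) (κh.⁻¹-homo g) ⟩
      κ g H.∙ κ (ι a) H.∙ κ g H.⁻¹         ≈⟨ H.∙-congʳ (H.∙-congˡ (im⊆ker a)) ⟩
      κ g H.∙ H.ε H.∙ κ g H.⁻¹             ≈⟨ H.∙-congʳ (H.identityʳ (κ g)) ⟩
      κ g H.∙ κ g H.⁻¹                     ≈⟨ H.inverseʳ (κ g) ⟩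
      H.ε                                  ∎
      where open SR H.setoid

    conj-ker : ∀ g a → κ g H.≈ H.ε → conj g (ι a) G.≈ ι a
    conj-ker g a k with ker⊆im g k
    ... | b , ιb≈g = begin
      conj g (ι a)                         ≈⟨ conj-cong (G.sym ιb≈g) G.refl ⟩
      ι b G.∙ ι a G.∙ ι b G.⁻¹             ≈⟨ G.∙-cong (ιh.homo b a) (ιh.⁻¹-homo b) ⟨
      ι (b A.∙ a) G.∙ ι (b A.⁻¹)           ≈⟨ ιh.homo (b A.∙ a) (b A.⁻¹) ⟨
      ι (b A.∙ a A.∙ b A.⁻¹)               ≈⟨ ιh.⟦⟧-cong eqA ⟩
      ι a                                  ∎
      where
      open SR G.setoid
      eqA : b A.∙ a A.∙ b A.⁻¹ A.≈ a
      eqA = A.trans (A.∙-congʳ (A.comm b a))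
              (A.trans (A.assoc a b (b A.⁻¹))
                (A.trans (A.∙-congˡ (A.inverseʳ b)) (A.identityʳ a)))

    conj-κ : ∀ g g' a → κ g H.≈ κ g' → conj g (ι a) G.≈ conj g' (ι a)
    conj-κ g g' a e = begin
      conj g (ι a)                   ≈⟨ conj-cong g≈ G.refl ⟨
      conj (g' G.∙ k) (ι a)          ≈⟨ conj-conj g' k (ι a) ⟨
      conj g' (conj k (ι a))         ≈⟨ conj-cong G.refl (conj-ker k a κk) ⟩
      conj g' (ι a)                  ∎
      where
      open SR G.setoid
      k = g' G.⁻¹ G.∙ g
      κk : κ k H.≈ H.ε
      κk = H.trans (κh.homo (g' G.⁻¹) g)
             (H.trans (H.∙-cong (H.trans (κh.⁻¹-homo g') (H.⁻¹-cong (H.sym e))) H.refl)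
               (H.inverseˡ (κ g)))
      g≈ : g' G.∙ k G.≈ g
      g≈ = G.trans (G.sym (G.assoc g' (g' G.⁻¹) g))
             (G.trans (G.∙-congʳ (G.inverseʳ g')) (G.identityˡ g))

  Ψ : H.Carrier → A.Carrier → A.Carrier
  Ψ h a = proj₁ (ker⊆im (conj (s h) (ι a)) (conj-inker (s h) a))

  ιΨ : ∀ h a → ι (Ψ h a) G.≈ conj (s h) (ι a)
  ιΨ h a = proj₂ (ker⊆im (conj (s h) (ι a)) (conj-inker (s h) a))

  Ψ-spec : ∀ g h a → κ g H.≈ h → ι (Ψ h a) G.≈ conj g (ι a)
  Ψ-spec g h a e = G.trans (ιΨ h a) (conj-κ (s h) g a (H.trans (κs h) (H.sym e)))

  private
    Ψ-cong : ∀ {h h' a a'} → h H.≈ h' → a A.≈ a' → Ψ h a A.≈ Ψ h' a'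
    Ψ-cong {h} {h'} {a} {a'} p q = ι-inj (begin
      ι (Ψ h a)           ≈⟨ Ψ-spec (s h') h a (H.trans (κs h') (H.sym p)) ⟩
      conj (s h') (ι a)   ≈⟨ conj-cong G.refl (ιh.⟦⟧-cong q) ⟩
      conj (s h') (ι a')  ≈⟨ ιΨ h' a' ⟨
      ι (Ψ h' a')         ∎)
      where open SR G.setoid

    Ψ-∙ : ∀ h a b → Ψ h (a A.∙ b) A.≈ Ψ h a A.∙ Ψ h b
    Ψ-∙ h a b = ι-inj (begin
      ι (Ψ h (a A.∙ b))                    ≈⟨ ιΨ h (a A.∙ b) ⟩
      conj (s h) (ι (a A.∙ b))             ≈⟨ conj-cong G.refl (ιh.homo a b) ⟩
      conj (s h) (ι a G.∙ ι b)             ≈⟨ conj-∙ (s h) (ι a) (ι b) ⟩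
      conj (s h) (ι a) G.∙ conj (s h) (ι b) ≈⟨ G.∙-cong (ιΨ h a) (ιΨ h b) ⟨
      ι (Ψ h a) G.∙ ι (Ψ h b)              ≈⟨ ιh.homo (Ψ h a) (Ψ h b) ⟨
      ι (Ψ h a A.∙ Ψ h b)                  ∎)
      where open SR G.setoid

    Ψ-Ψ : ∀ h h' a → Ψ h (Ψ h' a) A.≈ Ψ (h H.∙ h') a
    Ψ-Ψ h h' a = ι-inj (begin
      ι (Ψ h (Ψ h' a))                 ≈⟨ ιΨ h (Ψ h' a) ⟩
      conj (s h) (ι (Ψ h' a))          ≈⟨ conj-cong G.refl (ιΨ h' a) ⟩
      conj (s h) (conj (s h') (ι a))   ≈⟨ conj-conj (s h) (s h') (ι a) ⟩
      conj (s h G.∙ s h') (ι a)        ≈⟨ Ψ-spec (s h G.∙ s h') (h H.∙ h') a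
                                            (H.trans (κh.homo (s h) (s h'))
                                              (H.∙-cong (κs h) (κs h'))) ⟨
      ι (Ψ (h H.∙ h') a)               ∎)
      where open SR G.setoid

    Ψ-ε-act : ∀ a → Ψ H.ε a A.≈ a
    Ψ-ε-act a = ι-inj (G.trans (Ψ-spec G.ε H.ε a κh.ε-homo) (conj-ε (ι a)))

    Ψ-ε : ∀ h → Ψ h A.ε A.≈ A.ε
    Ψ-ε h = ι-inj (G.trans (ιΨ h A.ε)
              (G.trans (conj-cong G.refl ιh.ε-homo)
                (G.trans (conj-of-ε (s h)) (G.sym ιh.ε-homo))))

    C : Set c
    C = A.Carrier × H.Carrier

    infix 4 _≈_
    infixl 7 _∙_
    infix 8 _⁻¹
    _≈_ : C → C → Set ℓ
    x ≈ y = (proj₁ x A.≈ proj₁ y) × (proj₂ x H.≈ proj₂ y)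

    _∙_ : C → C → C
    (a₁ , h₁) ∙ (a₂ , h₂) = a₁ A.∙ Ψ h₁ a₂ , h₁ H.∙ h₂

    ε : C
    ε = A.ε , H.ε

    _⁻¹ : C → C
    (a , h) ⁻¹ = Ψ (h H.⁻¹) (a A.⁻¹) , h H.⁻¹

    sd-assoc : ∀ x y z → (x ∙ y) ∙ z ≈ x ∙ (y ∙ z)
    sd-assoc (a₁ , h₁) (a₂ , h₂) (a₃ , h₃) = A.sym (begin
      a₁ A.∙ Ψ h₁ (a₂ A.∙ Ψ h₂ a₃)            ≈⟨ A.∙-congˡ (Ψ-∙ h₁ a₂ (Ψ h₂ a₃)) ⟩
      a₁ A.∙ (Ψ h₁ a₂ A.∙ Ψ h₁ (Ψ h₂ a₃))     ≈⟨ A.∙-congˡ (A.∙-congˡ (Ψ-Ψ h₁ h₂ a₃)) ⟩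
      a₁ A.∙ (Ψ h₁ a₂ A.∙ Ψ (h₁ H.∙ h₂) a₃)   ≈⟨ A.assoc a₁ (Ψ h₁ a₂) (Ψ (h₁ H.∙ h₂) a₃) ⟨
      a₁ A.∙ Ψ h₁ a₂ A.∙ Ψ (h₁ H.∙ h₂) a₃     ∎) , H.assoc h₁ h₂ h₃
      where open SR A.setoid

  SemiDirect : Group c ℓ
  SemiDirect = record
    { Carrier = C
    ; _≈_ = _≈_
    ; _∙_ = _∙_
    ; ε = ε
    ; _⁻¹ = _⁻¹
    ; isGroup = record
      { isMonoid = record
        { isSemigroup = record
          { isMagma = record
            { isEquivalence = record
              { refl = A.refl , H.refl
              ; sym = λ p → A.sym (proj₁ p) , H.sym (proj₂ p)
              ; trans = λ p q → A.trans (proj₁ p) (proj₁ q) , H.trans (proj₂ p) (proj₂ q)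
              }
            ; ∙-cong = λ p q → A.∙-cong (proj₁ p) (Ψ-cong (proj₂ p) (proj₁ q))
                             , H.∙-cong (proj₂ p) (proj₂ q)
            }
          ; assoc = sd-assoc
          }
        ; identity = (λ x → A.trans (A.identityˡ _) (Ψ-ε-act (proj₁ x)) , H.identityˡ (proj₂ x))
                   , (λ x → A.trans (A.∙-congˡ (Ψ-ε (proj₂ x))) (A.identityʳ (proj₁ x))
                          , H.identityʳ (proj₂ x))
        }
      ; inverse =
          (λ x → A.trans (A.sym (Ψ-∙ (proj₂ x H.⁻¹) (proj₁ x A.⁻¹) (proj₁ x)))
                   (A.trans (Ψ-cong H.refl (A.inverseˡ (proj₁ x))) (Ψ-ε (proj₂ x H.⁻¹)))
                 , H.inverseˡ (proj₂ x))
        , (λ x → A.trans (A.∙-congˡ (A.trans (Ψ-Ψ (proj₂ x) (proj₂ x H.⁻¹) (proj₁ x A.⁻¹))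
                                       (A.trans (Ψ-cong (H.inverseʳ (proj₂ x)) A.refl)
                                                (Ψ-ε-act (proj₁ x A.⁻¹)))))
                   (A.inverseʳ (proj₁ x))
                 , H.inverseʳ (proj₂ x))
      ; ⁻¹-cong = λ p → Ψ-cong (H.⁻¹-cong (proj₂ p)) (A.⁻¹-cong (proj₁ p)) , H.⁻¹-cong (proj₂ p)
      }
    }

  π : C → H.Carrier
  π = proj₂

  π-hom : IsGroupHomomorphism (Group.rawGroup SemiDirect) H.rawGroup π
  π-hom = record
    { isMonoidHomomorphism = record
      { isMagmaHomomorphism = record
        { isRelHomomorphism = record { cong = proj₂ }
        ; homo = λ _ _ → H.refl
        }
      ; ε-homo = H.refl
      }
    ; ⁻¹-homo = λ _ → H.refl
    }

  GG : Group (c ⊔ ℓ) ℓ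
  GG = FibreProduct G G H κ κ-hom κ κ-hom

  GSD : Group (c ⊔ ℓ) ℓ
  GSD = FibreProduct G SemiDirect H κ κ-hom π π-hom

  Diag : Pred (Group.Carrier GG) (c ⊔ ℓ)
  Diag x = Σ A.Carrier λ a → (ι a G.≈ proj₁ (proj₁ x)) × (ι a G.≈ proj₂ (proj₁ x))

-- Everything is read off the homomorphism ρ : G ×_H G → A ⋊ H, (g₁ , g₂) ↦ (g₁ g₂⁻¹ , κ g₁),
-- where g₁ g₂⁻¹ lies in A because κ g₁ = κ g₂. It is a homomorphism because
-- (g₁h₁)(g₂h₂)⁻¹ = (g₁g₂⁻¹) · g₂(h₁h₂⁻¹)g₂⁻¹ and conjugation by g₂ is Ψ (κ g₁) on A.
-- Since g₁ = (g₁g₂⁻¹) g₂, the map (g₁ , g₂) ↦ (g₂ , ρ(g₁ , g₂)) is an isomorphism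
-- G ×_H G ≅ G ×_H (A ⋊ H). The kernel of ρ is the diagonal of A, and ρ has the
-- section (a , h) ↦ (a s(h) , s(h)) for any set-theoretic section s of κ, which
-- gives A ⋊ H ≅ (G ×_H G)/{(a , a)}.
module Submission where

open import Defs
open import Data.Product using (Σ; _×_; _,_; proj₁; proj₂)
open import Relation.Unary using (Pred)
open import Algebra.Bundles using (Group; AbelianGroup)
open import Algebra.Morphism.Structures using (IsGroupHomomorphism)
import Algebra.Properties.Group as GroupProperties
import Algebra.Properties.Monoid as MonoidProperties
import Relation.Binary.Reasoning.Setoid as SetoidReasoning

module _ {a ℓ} (G : Group a ℓ) where
  open Group G
  open GroupProperties G using (⁻¹-anti-homo-∙)
  open MonoidProperties monoid using (cancelˡ)
  open Conj G
  open SetoidReasoning setoid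

  x∙y∙[u∙v]⁻¹≈x∙u⁻¹∙conj-u[y∙v⁻¹] : ∀ x y u v →
    x ∙ y ∙ (u ∙ v) ⁻¹ ≈ x ∙ u ⁻¹ ∙ conj u (y ∙ v ⁻¹)
  x∙y∙[u∙v]⁻¹≈x∙u⁻¹∙conj-u[y∙v⁻¹] x y u v = begin
    x ∙ y ∙ (u ∙ v) ⁻¹                  ≈⟨ assoc x y _ ⟩
    x ∙ (y ∙ (u ∙ v) ⁻¹)                ≈⟨ ∙-congˡ (∙-congˡ (⁻¹-anti-homo-∙ u v)) ⟩
    x ∙ (y ∙ (v ⁻¹ ∙ u ⁻¹))             ≈⟨ ∙-congˡ (assoc y (v ⁻¹) (u ⁻¹)) ⟨
    x ∙ (y ∙ v ⁻¹ ∙ u ⁻¹)               ≈⟨ ∙-congˡ (cancelˡ (inverseˡ u) _) ⟨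
    x ∙ (u ⁻¹ ∙ (u ∙ (y ∙ v ⁻¹ ∙ u ⁻¹))) ≈⟨ assoc x (u ⁻¹) _ ⟨
    x ∙ u ⁻¹ ∙ (u ∙ (y ∙ v ⁻¹ ∙ u ⁻¹))   ≈⟨ ∙-congˡ (assoc u (y ∙ v ⁻¹) (u ⁻¹)) ⟨
    x ∙ u ⁻¹ ∙ conj u (y ∙ v ⁻¹)         ∎

module _ {a ℓa b ℓb} (G : Group a ℓa) (K : Group b ℓb) where
  private
    module G = Group G
    module K = Group K

  isGroupHomomorphism : (f : G.Carrier → K.Carrier) →
    (∀ {x y} → x G.≈ y → f x K.≈ f y) →
    (∀ x y → f (x G.∙ y) K.≈ f x K.∙ f y) →
    IsGroupHomomorphism G.rawGroup K.rawGroup f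
  isGroupHomomorphism f cong homo = record
    { isMonoidHomomorphism = record
      { isMagmaHomomorphism = record
        { isRelHomomorphism = record { cong = cong }
        ; homo = homo
        }
      ; ε-homo = ε-homo
      }
    ; ⁻¹-homo = λ x → GroupProperties.inverseˡ-unique K (f (x G.⁻¹)) (f x)
        (K.trans (K.sym (homo (x G.⁻¹) x)) (K.trans (cong (G.inverseˡ x)) ε-homo))
    }
    where
    open SetoidReasoning K.setoid
    open MonoidProperties K.monoid using (cancelʳ)
    ε-homo : f G.ε K.≈ K.ε
    ε-homo = begin
      f G.ε                               ≈⟨ cancelʳ (K.inverseʳ (f G.ε)) (f G.ε) ⟨
      f G.ε K.∙ f G.ε K.∙ f G.ε K.⁻¹      ≈⟨ K.∙-congʳ (homo G.ε G.ε) ⟨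
      f (G.ε G.∙ G.ε) K.∙ f G.ε K.⁻¹      ≈⟨ K.∙-congʳ (cong (G.identityˡ G.ε)) ⟩
      f G.ε K.∙ f G.ε K.⁻¹                ≈⟨ K.inverseʳ (f G.ε) ⟩
      K.ε                                 ∎

module _ {a ℓa b ℓb p} (G : Group a ℓa) (K : Group b ℓb)
         {f : Group.Carrier G → Group.Carrier K}
         (f-hom : IsGroupHomomorphism (Group.rawGroup G) (Group.rawGroup K) f)
         {N : Pred (Group.Carrier G) p}
         (N⇒ker : ∀ {x} → N x → Group._≈_ K (f x) (Group.ε K))
         (ker⇒N : ∀ {x} → Group._≈_ K (f x) (Group.ε K) → N x)
         where
  private
    module G = Group G
    module K = Group K
    module f = IsGroupHomomorphism f-hom
    open GroupProperties K using (ε⁻¹≈ε; x∙y⁻¹≈ε⇒x≈y)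

  kernel-isNormalSubgroup : IsNormalSubgroup G N
  kernel-isNormalSubgroup = record
    { resp = λ x≈y Nx → ker⇒N (K.trans (f.⟦⟧-cong (G.sym x≈y)) (N⇒ker Nx))
    ; has-ε = ker⇒N f.ε-homo
    ; ∙-closed = λ {x} {y} Nx Ny → ker⇒N (begin
        f (x G.∙ y)         ≈⟨ f.homo x y ⟩
        f x K.∙ f y         ≈⟨ K.∙-cong (N⇒ker Nx) (N⇒ker Ny) ⟩
        K.ε K.∙ K.ε         ≈⟨ K.identityˡ K.ε ⟩
        K.ε                 ∎)
    ; ⁻¹-closed = λ {x} Nx → ker⇒N (begin
        f (x G.⁻¹)          ≈⟨ f.⁻¹-homo x ⟩
        f x K.⁻¹            ≈⟨ K.⁻¹-cong (N⇒ker Nx) ⟩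
        K.ε K.⁻¹            ≈⟨ ε⁻¹≈ε ⟩
        K.ε                 ∎)
    ; conj-closed = λ g {x} Nx → ker⇒N (begin
        f (g G.∙ x G.∙ g G.⁻¹)        ≈⟨ f.homo (g G.∙ x) (g G.⁻¹) ⟩
        f (g G.∙ x) K.∙ f (g G.⁻¹)    ≈⟨ K.∙-cong (f.homo g x) (f.⁻¹-homo g) ⟩
        f g K.∙ f x K.∙ f g K.⁻¹      ≈⟨ K.∙-congʳ (K.∙-congˡ (N⇒ker Nx)) ⟩
        f g K.∙ K.ε K.∙ f g K.⁻¹      ≈⟨ K.∙-congʳ (K.identityʳ (f g)) ⟩
        f g K.∙ f g K.⁻¹              ≈⟨ K.inverseʳ (f g) ⟩
        K.ε                           ∎)
    }
    where open SetoidReasoning K.setoid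

  module _ (nor : IsNormalSubgroup G N) where
    private
      module Q = Group (Quotient G N nor)

    ≈-image⇒≈-quotient : ∀ {x y} → f x K.≈ f y → x Q.≈ y
    ≈-image⇒≈-quotient {x} {y} fx≈fy = ker⇒N (begin
      f (x G.∙ y G.⁻¹)   ≈⟨ f.homo x (y G.⁻¹) ⟩
      f x K.∙ f (y G.⁻¹) ≈⟨ K.∙-congʳ fx≈fy ⟩
      f y K.∙ f (y G.⁻¹) ≈⟨ K.∙-congˡ (f.⁻¹-homo y) ⟩
      f y K.∙ f y K.⁻¹   ≈⟨ K.inverseʳ (f y) ⟩
      K.ε                ∎)
      where open SetoidReasoning K.setoid

    ≈-quotient⇒≈-image : ∀ {x y} → x Q.≈ y → f x K.≈ f y
    ≈-quotient⇒≈-image {x} {y} x∼y = x∙y⁻¹≈ε⇒x≈y (f x) (f y) (begin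
      f x K.∙ f y K.⁻¹   ≈⟨ K.∙-congˡ (f.⁻¹-homo y) ⟨
      f x K.∙ f (y G.⁻¹) ≈⟨ f.homo x (y G.⁻¹) ⟨
      f (x G.∙ y G.⁻¹)   ≈⟨ N⇒ker x∼y ⟩
      K.ε                ∎)
      where open SetoidReasoning K.setoid

    -- A set-theoretic section σ of f is automatically a homomorphism into G/N,
    -- since elements of G/N are equal as soon as their images under f are.
    section-≅-Quotient : (σ : K.Carrier → G.Carrier) → (∀ k → f (σ k) K.≈ k) →
      K ≅ Quotient G N nor
    section-≅-Quotient σ f∘σ≈id = σ , record
      { isGroupMonomorphism = record
        { isGroupHomomorphism = isGroupHomomorphism K (Quotient G N nor) σ
            (λ {k} {k'} k≈k' → ≈-image⇒≈-quotient
              (K.trans (f∘σ≈id k) (K.trans k≈k' (K.sym (f∘σ≈id k')))))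
            (λ k k' → ≈-image⇒≈-quotient (begin
              f (σ (k K.∙ k'))        ≈⟨ f∘σ≈id (k K.∙ k') ⟩
              k K.∙ k'                ≈⟨ K.∙-cong (f∘σ≈id k) (f∘σ≈id k') ⟨
              f (σ k) K.∙ f (σ k')    ≈⟨ f.homo (σ k) (σ k') ⟨
              f (σ k G.∙ σ k')        ∎))
        ; injective = λ {k} {k'} σk∼σk' →
            K.trans (K.sym (f∘σ≈id k)) (K.trans (≈-quotient⇒≈-image σk∼σk') (f∘σ≈id k'))
        }
      ; surjective = λ x → f x , λ {k} k≈fx →
          ≈-image⇒≈-quotient (K.trans (f∘σ≈id k) k≈fx)
      }
      where open SetoidReasoning K.setoid

module FibreSquare {c ℓ} {A : AbelianGroup c ℓ} {G H : Group c ℓ} (E : ShortExact A G H) where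
  open ShortExact E
  open SES E
  private
    module A = AbelianGroup A
    module G = Group G
    module H = Group H
    module GG = Group GG
    module GSD = Group GSD
    module A⋊H = Group SemiDirect
    module ι = IsGroupHomomorphism ι-hom
    module κ = IsGroupHomomorphism κ-hom
    open GroupProperties G using (x∙y⁻¹≈ε⇒x≈y; x≈y⇒x∙y⁻¹≈ε)
    open MonoidProperties G.monoid using (cancelʳ)
    open Conj G

  fst snd : GG.Carrier → G.Carrier
  fst x = proj₁ (proj₁ x)
  snd x = proj₂ (proj₁ x)

  private
    κ[fst∙snd⁻¹]≈ε : ∀ x → κ (fst x G.∙ snd x G.⁻¹) H.≈ H.ε
    κ[fst∙snd⁻¹]≈ε x = begin
      κ (fst x G.∙ snd x G.⁻¹)   ≈⟨ κ.homo (fst x) (snd x G.⁻¹) ⟩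
      κ (fst x) H.∙ κ (snd x G.⁻¹) ≈⟨ H.∙-cong (proj₂ x) (κ.⁻¹-homo (snd x)) ⟩
      κ (snd x) H.∙ κ (snd x) H.⁻¹ ≈⟨ H.inverseʳ (κ (snd x)) ⟩
      H.ε                        ∎
      where open SetoidReasoning H.setoid

  difference : GG.Carrier → A.Carrier
  difference x = proj₁ (ker⊆im _ (κ[fst∙snd⁻¹]≈ε x))

  ι-difference : ∀ x → ι (difference x) G.≈ fst x G.∙ snd x G.⁻¹
  ι-difference x = proj₂ (ker⊆im _ (κ[fst∙snd⁻¹]≈ε x))

  fst≈ι-difference∙snd : ∀ x → fst x G.≈ ι (difference x) G.∙ snd x
  fst≈ι-difference∙snd x = G.trans (G.sym (cancelʳ (G.inverseˡ (snd x)) (fst x)))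
                                   (G.∙-congʳ (G.sym (ι-difference x)))

  ρ : GG.Carrier → A⋊H.Carrier
  ρ x = difference x , κ (fst x)

  ρ-cong : ∀ {x y} → x GG.≈ y → ρ x A⋊H.≈ ρ y
  ρ-cong {x} {y} (fst≈ , snd≈) =
      ι-inj (G.trans (ι-difference x)
              (G.trans (G.∙-cong fst≈ (G.⁻¹-cong snd≈)) (G.sym (ι-difference y))))
    , κ.⟦⟧-cong fst≈

  ρ-homo : ∀ x y → ρ (x GG.∙ y) A⋊H.≈ ρ x A⋊H.∙ ρ y
  ρ-homo x y = ι-inj (begin
      ι (difference (x GG.∙ y))
        ≈⟨ ι-difference (x GG.∙ y) ⟩
      fst x G.∙ fst y G.∙ (snd x G.∙ snd y) G.⁻¹
        ≈⟨ x∙y∙[u∙v]⁻¹≈x∙u⁻¹∙conj-u[y∙v⁻¹] G (fst x) (fst y) (snd x) (snd y) ⟩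
      fst x G.∙ snd x G.⁻¹ G.∙ conj (snd x) (fst y G.∙ snd y G.⁻¹)
        ≈⟨ G.∙-cong (ι-difference x) (conj-cong G.refl (ι-difference y)) ⟨
      ι (difference x) G.∙ conj (snd x) (ι (difference y))
        ≈⟨ G.∙-congˡ (Ψ-spec (snd x) (κ (fst x)) (difference y) (H.sym (proj₂ x))) ⟨
      ι (difference x) G.∙ ι (Ψ (κ (fst x)) (difference y))
        ≈⟨ ι.homo _ _ ⟨
      ι (difference x A.∙ Ψ (κ (fst x)) (difference y)) ∎)
    , κ.homo (fst x) (fst y)
    where open SetoidReasoning G.setoid

  ρ-isGroupHomomorphism : IsGroupHomomorphism GG.rawGroup A⋊H.rawGroup ρ
  ρ-isGroupHomomorphism = isGroupHomomorphism GG SemiDirect ρ ρ-cong ρ-homo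

  lift : A.Carrier → G.Carrier → GG.Carrier
  lift a g = (ι a G.∙ g , g) , H.trans (κ.homo (ι a) g)
                                 (H.trans (H.∙-congʳ (im⊆ker a)) (H.identityˡ (κ g)))

  ρ-lift : ∀ a g → ρ (lift a g) A⋊H.≈ (a , κ g)
  ρ-lift a g = ι-inj (G.trans (ι-difference (lift a g)) (cancelʳ (G.inverseʳ g) (ι a)))
             , proj₂ (lift a g)

  section : A⋊H.Carrier → GG.Carrier
  section (a , h) = lift a (s h)

  ρ∘section≈id : ∀ x → ρ (section x) A⋊H.≈ x
  ρ∘section≈id (a , h) = A⋊H.trans (ρ-lift a (s h)) (A.refl , κs h)

  Diag⇒ker-ρ : ∀ {x} → Diag x → ρ x A⋊H.≈ A⋊H.ε
  Diag⇒ker-ρ {x} (b , ιb≈fst , ιb≈snd) =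
      ι-inj (G.trans (ι-difference x)
              (G.trans (x≈y⇒x∙y⁻¹≈ε (G.trans (G.sym ιb≈fst) ιb≈snd)) (G.sym ι.ε-homo)))
    , H.trans (κ.⟦⟧-cong (G.sym ιb≈fst)) (im⊆ker b)

  ker-ρ⇒Diag : ∀ {x} → ρ x A⋊H.≈ A⋊H.ε → Diag x
  ker-ρ⇒Diag {x} (difference≈ε , κfst≈ε) with ker⊆im (fst x) κfst≈ε
  ... | b , ιb≈fst = b , ιb≈fst , G.trans ιb≈fst fst≈snd
    where
    fst≈snd : fst x G.≈ snd x
    fst≈snd = x∙y⁻¹≈ε⇒x≈y (fst x) (snd x)
      (G.trans (G.sym (ι-difference x)) (G.trans (ι.⟦⟧-cong difference≈ε) ι.ε-homo))

  toGSD : GG.Carrier → GSD.Carrier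
  toGSD x = (snd x , ρ x) , H.sym (proj₂ x)

  GG≅GSD : GG ≅ GSD
  GG≅GSD = toGSD , record
    { isGroupMonomorphism = record
      { isGroupHomomorphism = toGSD-isGroupHomomorphism
      ; injective = toGSD-injective
      }
    ; surjective = λ ((g , a , h) , κg≈h) → lift a g , λ {x} x≈lift →
        proj₂ x≈lift
      , A⋊H.trans (ρ-cong {x} {lift a g} x≈lift) (A⋊H.trans (ρ-lift a g) (A.refl , κg≈h))
    }
    where
    toGSD-isGroupHomomorphism : IsGroupHomomorphism GG.rawGroup GSD.rawGroup toGSD
    toGSD-isGroupHomomorphism = isGroupHomomorphism GG GSD toGSD
      (λ {x} {y} x≈y → proj₂ x≈y , ρ-cong {x} {y} x≈y)
      (λ x y → G.refl , ρ-homo x y)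

    toGSD-injective : ∀ {x y} → toGSD x GSD.≈ toGSD y → x GG.≈ y
    toGSD-injective {x} {y} (snd≈ , difference≈ , _) =
        G.trans (fst≈ι-difference∙snd x)
          (G.trans (G.∙-cong (ι.⟦⟧-cong difference≈) snd≈) (G.sym (fst≈ι-difference∙snd y)))
      , snd≈

theorem4p5 : ∀ {c ℓ} (A : AbelianGroup c ℓ) (G H : Group c ℓ) (E : ShortExact A G H) →
    IsFiniteGroup (AbelianGroup.group A) → IsFiniteGroup G → IsFiniteGroup H →
    (SES.GG E ≅ SES.GSD E)
    × Σ (IsNormalSubgroup (SES.GG E) (SES.Diag E))
        (λ nor → SES.SemiDirect E ≅ Quotient (SES.GG E) (SES.Diag E) nor)
theorem4p5 A G H E _ _ _ =
  GG≅GSD , Diag-normal ,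
  section-≅-Quotient GG SemiDirect ρ-isGroupHomomorphism Diag⇒ker-ρ ker-ρ⇒Diag
    Diag-normal section ρ∘section≈id
  where
  open SES E
  open FibreSquare E
  Diag-normal : IsNormalSubgroup GG Diag
  Diag-normal = kernel-isNormalSubgroup GG SemiDirect ρ-isGroupHomomorphism Diag⇒ker-ρ ker-ρ⇒Diag
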